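{- Let $G$ and $H$ be finite connected graphs with $|V(G)|=m$, $|V(H)| =n$ and $\gcd(m,n) =1$. Then $\mathsf{DL}^\circ( G\, \Box \, H) \ge \mathsf{DL}^\circ(G)+\mathsf{DL}^\circ(H)$.
   Context: For a finite connected graph $G=(V,E)$ with $|V|=N$ and graph distance $d$, a $k$-circular-dispersed labelling is a bijection $\phi:\mathbb{Z}_N\to V$ with $d(\phi(i),\phi(i+1))\ge k$ for all $i\in\mathbb{Z}_N$ (indices mod $N$); $\mathsf{DL}^\circ(G)$ is the maximum such $k$. The Cartesian product $G\,\Box\,H$ has vertex set $V(G)\times V(H)$, with $(u,v)\sim(u',v')$ iff either $u=u'$ and $\{v,v'\}\in E(H)$, or $\{u,u'\}\in E(G)$ and $v=v'$. -}

module Defs where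

open import Data.Nat using (ℕ; zero; suc; _≤_)
open import Data.Fin using (Fin; toℕ)
open import Data.Nat.DivMod using (_mod_)
open import Data.Product using (Σ; _×_; _,_; ∃)
open import Data.Sum using (_⊎_; inj₁; inj₂)
open import Data.Empty using (⊥)
open import Relation.Binary.PropositionalEquality using (_≡_; refl)
open import Function.Bundles using (_⤖_; Bijection)

record Graph : Set₁ where
  field
    V     : Set
    Adj   : V → V → Set
    sym   : ∀ {u v} → Adj u v → Adj v u
    irrefl : ∀ {u} → Adj u u → ⊥
open Graph public

data Walk (G : Graph) : V G → V G → ℕ → Set where
  here : ∀ {u} → Walk G u u zero
  step : ∀ {u v w ℓ} → Adj G u v → Walk G v w ℓ → Walk G u w (suc ℓ)

Connected : Graph → Set
Connected G = ∀ (u v : V G) → ∃ λ ℓ → Walk G u v ℓ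

HasOrder : Graph → ℕ → Set
HasOrder G N = V G ⤖ Fin N

-- d(u,v) ≥ k : every walk from u to v has length at least k.
DistGe : (G : Graph) → V G → V G → ℕ → Set
DistGe G u v k = ∀ ℓ → Walk G u v ℓ → k ≤ ℓ

cyc : ∀ {n} → Fin (suc n) → Fin (suc n)
cyc {n} i = suc (toℕ i) mod (suc n)

-- a k-circular-dispersed labelling exists (bijection ℤ_N → V with N = |V| ≥ 1)
HasCDL : Graph → ℕ → Set
HasCDL G k = Σ ℕ λ n → Σ (Fin (suc n) ⤖ V G) λ φ →
  ∀ i → DistGe G (Bijection.to φ i) (Bijection.to φ (cyc i)) k

IsDL : Graph → ℕ → Set
IsDL G k = HasCDL G k × (∀ k′ → HasCDL G k′ → k′ ≤ k)

□-Adj : (G H : Graph) → V G × V H → V G × V H → Set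
□-Adj G H (u , v) (u′ , v′) = (u ≡ u′ × Adj H v v′) ⊎ (Adj G u u′ × v ≡ v′)

□-sym : (G H : Graph) → ∀ {x y} → □-Adj G H x y → □-Adj G H y x
□-sym G H (inj₁ (refl , a)) = inj₁ (refl , sym H a)
□-sym G H (inj₂ (a , refl)) = inj₂ (sym G a , refl)

□-irrefl : (G H : Graph) → ∀ {x} → □-Adj G H x x → ⊥
□-irrefl G H (inj₁ (_ , a)) = irrefl H a
□-irrefl G H (inj₂ (a , _)) = irrefl G a

_□_ : Graph → Graph → Graph
G □ H = record
  { V = V G × V H
  ; Adj = □-Adj G H
  ; sym = □-sym G H
  ; irrefl = □-irrefl G H
  }

-- Let φ and ψ be circular-dispersed labellings of G and H, with m = |V G| and n = |V H|
-- coprime. By the Chinese remainder theorem i ↦ (φ (i mod m) , ψ (i mod n)) is a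
-- bijection ℤ_{mn} → V (G □ H), and it sends consecutive labels to consecutive labels
-- in both coordinates. A walk in G □ H projects to walks in G and H whose lengths add
-- up, so consecutive vertices of the product labelling are at distance at least
-- DL°(G) + DL°(H).
module Submission where

open import Defs hiding (sym)
open import Data.Nat using (ℕ; zero; suc; _+_; _*_; _∸_; _%_; _/_; _≤_; _<_; NonZero)
open import Data.Nat.Properties
  using (≤-total; ≤-<-trans; <-irrefl; +-mono-≤; +-suc; m∸n≤m; m∸n+n≡m; *-assoc; *-comm;
         *-distribʳ-∸; [m+n]∸[m+o]≡n∸o; m*n≢0)
open import Data.Nat.DivMod
  using (_mod_; m≡m%n+[m/n]*n; m∣n⇒o%n%m≡o%m; %-distribˡ-+; m%n%n≡m%n; m%n<n; m<n⇒m%n≡m)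
open import Data.Nat.Divisibility using (_∣_; divides; ∣-refl; n∣m⇒m%n≡0; ∣m⇒∣m*n; ∣n⇒∣m*n)
open import Data.Nat.GCD using (gcd)
open import Data.Nat.Coprimality using (Coprime; gcd≡1⇒coprime; coprime-divisor)
open import Data.Fin using (Fin; toℕ; combine; punchOut)
open import Data.Fin.Properties
  using (toℕ-fromℕ<; toℕ-injective; toℕ<n; any?; punchOut-injective; injective⇒≤;
         combine-injective; cantor-schröder-bernstein)
  renaming (_≟_ to _≟ᶠ_)
open import Data.Product using (_×_; _,_; proj₁; proj₂; ∃₂; uncurry)
open import Data.Product.Function.NonDependent.Propositional using (_×-⤖_)
open import Data.Sum using (_⊎_; inj₁; inj₂)
open import Data.Empty using (⊥-elim)
open import Relation.Binary.PropositionalEquality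
  using (_≡_; _≢_; refl; sym; trans; cong; cong₂; subst; subst₂; module ≡-Reasoning)
open import Relation.Nullary using (yes; no)
open import Function.Base using (_∘_)
open import Function.Bundles using (_⤖_; Bijection; mk⤖)
open import Function.Definitions using (Injective; StrictlySurjective)
open import Function.Consequences.Propositional using (strictlySurjective⇒surjective)
open import Function.Construct.Composition using (_⤖-∘_)
open import Function.Construct.Symmetry using (⤖-sym)

Fin-injective⇒surjective : ∀ {N} {f : Fin N → Fin N} →
  Injective _≡_ _≡_ f → StrictlySurjective _≡_ f
Fin-injective⇒surjective {zero}  _     ()
Fin-injective⇒surjective {suc N} {f} f-inj y with any? (λ x → f x ≟ᶠ y)
... | yes hit = hit
... | no miss = ⊥-elim (<-irrefl refl (injective⇒≤ avoid-y-injective))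
  where
  -- if y is missed, f squeezes Fin (suc N) into the N values other than y
  f≢y : ∀ x → y ≢ f x
  f≢y x eq = miss (x , sym eq)

  avoid-y : Fin (suc N) → Fin N
  avoid-y x = punchOut (f≢y x)

  avoid-y-injective : Injective _≡_ _≡_ avoid-y
  avoid-y-injective {x} {x′} eq = f-inj (punchOut-injective (f≢y x) (f≢y x′) eq)

⤖-card : ∀ {a b} {W : Set} → Fin a ⤖ W → W ⤖ Fin b → a ≡ b
⤖-card φ χ = cantor-schröder-bernstein
  (Bijection.injective (χ ⤖-∘ φ)) (Bijection.injective (⤖-sym (χ ⤖-∘ φ)))

%-≡⇒∣∸ : ∀ d i j .{{_ : NonZero d}} → i % d ≡ j % d → d ∣ j ∸ i
%-≡⇒∣∸ d i j eq = divides (j / d ∸ i / d) (begin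
  j ∸ i                                         ≡⟨ cong₂ _∸_ (m≡m%n+[m/n]*n j d) (m≡m%n+[m/n]*n i d) ⟩
  (j % d + j / d * d) ∸ (i % d + i / d * d)     ≡⟨ cong (λ r → (r + j / d * d) ∸ (i % d + i / d * d)) (sym eq) ⟩
  (i % d + j / d * d) ∸ (i % d + i / d * d)     ≡⟨ [m+n]∸[m+o]≡n∸o (i % d) (j / d * d) (i / d * d) ⟩
  j / d * d ∸ i / d * d                         ≡⟨ *-distribʳ-∸ d (j / d) (i / d) ⟨
  (j / d ∸ i / d) * d                           ∎)
  where open ≡-Reasoning

coprime-*-∣ : ∀ {m n o} → Coprime m n → m ∣ o → n ∣ o → m * n ∣ o
coprime-*-∣ {m} {n} {o} cop m∣o (divides k o≡k*n)
  with divides r k≡r*m ← coprime-divisor {o = k} cop (subst (m ∣_) (trans o≡k*n (*-comm k n)) m∣o)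
  = divides r (begin
    o           ≡⟨ o≡k*n ⟩
    k * n       ≡⟨ cong (_* n) k≡r*m ⟩
    r * m * n   ≡⟨ *-assoc r m n ⟩
    r * (m * n) ∎)
  where open ≡-Reasoning

suc-%-% : ∀ a d .{{_ : NonZero d}} → suc (a % d) % d ≡ suc a % d
suc-%-% a d = begin
  (1 + a % d) % d           ≡⟨ %-distribˡ-+ 1 (a % d) d ⟩
  (1 % d + a % d % d) % d   ≡⟨ cong (λ r → (1 % d + r) % d) (m%n%n≡m%n a d) ⟩
  (1 % d + a % d) % d       ≡⟨ %-distribˡ-+ 1 a d ⟨
  (1 + a) % d               ∎
  where open ≡-Reasoning

coprime-%-≡⇒≡ : ∀ {m n i j} {{_ : NonZero m}} {{_ : NonZero n}} → Coprime m n →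
  i ≤ j → j < m * n → i % m ≡ j % m → i % n ≡ j % n → i ≡ j
coprime-%-≡⇒≡ {m} {n} {i} {j} cop i≤j j<mn eₘ eₙ = sym (begin
  j           ≡⟨ m∸n+n≡m i≤j ⟨
  j ∸ i + i   ≡⟨ cong (_+ i) j∸i≡0 ⟩
  i           ∎)
  where
  open ≡-Reasoning
  instance
    mn≢0 : NonZero (m * n)
    mn≢0 = m*n≢0 m n
  j∸i≡0 : j ∸ i ≡ 0
  j∸i≡0 = trans (sym (m<n⇒m%n≡m (≤-<-trans (m∸n≤m j i) j<mn)))
                (n∣m⇒m%n≡0 (j ∸ i) (m * n) (coprime-*-∣ cop (%-≡⇒∣∸ m i j eₘ) (%-≡⇒∣∸ n i j eₙ)))

residue : ∀ {N e} → Fin N → Fin (suc e)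
residue i = toℕ i mod _

toℕ-residue : ∀ {N e} (i : Fin N) → toℕ (residue {e = e} i) ≡ toℕ i % suc e
toℕ-residue i = toℕ-fromℕ< _

residue-cyc : ∀ {N e} → suc e ∣ suc N → (i : Fin (suc N)) → residue (cyc i) ≡ cyc (residue {e = e} i)
residue-cyc {N} {e} d∣N i = toℕ-injective (begin
  toℕ (residue (cyc i))        ≡⟨ toℕ-residue (cyc i) ⟩
  toℕ (cyc i) % d              ≡⟨ cong (_% d) (toℕ-fromℕ< (m%n<n (suc (toℕ i)) (suc N))) ⟩
  suc (toℕ i) % suc N % d      ≡⟨ m∣n⇒o%n%m≡o%m d (suc N) (suc (toℕ i)) d∣N ⟩
  suc (toℕ i) % d              ≡⟨ suc-%-% (toℕ i) d ⟨
  suc (toℕ i % d) % d          ≡⟨ cong (λ r → suc r % d) (toℕ-residue i) ⟨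
  suc (toℕ (residue i)) % d    ≡⟨ toℕ-fromℕ< _ ⟨
  toℕ (cyc (residue i))        ∎)
  where
  open ≡-Reasoning
  d = suc e

module _ {p q : ℕ} (cop : Coprime (suc p) (suc q)) where

  crt : Fin (suc p * suc q) → Fin (suc p) × Fin (suc q)
  crt i = residue i , residue i

  crt-injective : Injective _≡_ _≡_ crt
  crt-injective {i} {j} eq = toℕ-injective (by-order (≤-total (toℕ i) (toℕ j)))
    where
    eₘ : toℕ i % suc p ≡ toℕ j % suc p
    eₘ = trans (sym (toℕ-residue i)) (trans (cong (toℕ ∘ proj₁) eq) (toℕ-residue j))
    eₙ : toℕ i % suc q ≡ toℕ j % suc q
    eₙ = trans (sym (toℕ-residue i)) (trans (cong (toℕ ∘ proj₂) eq) (toℕ-residue j))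
    by-order : toℕ i ≤ toℕ j ⊎ toℕ j ≤ toℕ i → toℕ i ≡ toℕ j
    by-order (inj₁ i≤j) = coprime-%-≡⇒≡ cop i≤j (toℕ<n j) eₘ eₙ
    by-order (inj₂ j≤i) = sym (coprime-%-≡⇒≡ cop j≤i (toℕ<n i) (sym eₘ) (sym eₙ))

  combine∘crt-injective : Injective _≡_ _≡_ (uncurry combine ∘ crt)
  combine∘crt-injective eq = crt-injective (uncurry (cong₂ _,_) (combine-injective _ _ _ _ eq))

  crt-surjective : StrictlySurjective _≡_ crt
  crt-surjective (a , b)
    with i , eq ← Fin-injective⇒surjective combine∘crt-injective (combine a b)
    = i , uncurry (cong₂ _,_) (combine-injective _ _ a b eq)

  crt-bijection : Fin (suc p * suc q) ⤖ (Fin (suc p) × Fin (suc q))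
  crt-bijection = mk⤖ (crt-injective , strictlySurjective⇒surjective crt-surjective)

□-walk-split : ∀ {G H u v u′ v′ ℓ} → Walk (G □ H) (u , v) (u′ , v′) ℓ →
  ∃₂ λ ℓ₁ ℓ₂ → Walk G u u′ ℓ₁ × Walk H v v′ ℓ₂ × ℓ₁ + ℓ₂ ≡ ℓ
□-walk-split here = 0 , 0 , here , here , refl
□-walk-split (step (inj₁ (refl , a)) w) with ℓ₁ , ℓ₂ , w₁ , w₂ , eq ← □-walk-split w
  = ℓ₁ , suc ℓ₂ , w₁ , step a w₂ , trans (+-suc ℓ₁ ℓ₂) (cong suc eq)
□-walk-split (step (inj₂ (a , refl)) w) with ℓ₁ , ℓ₂ , w₁ , w₂ , eq ← □-walk-split w
  = suc ℓ₁ , ℓ₂ , step a w₁ , w₂ , cong suc eq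

DistGe-□ : ∀ {G H u v u′ v′ a b} → DistGe G u u′ a → DistGe H v v′ b →
  DistGe (G □ H) (u , v) (u′ , v′) (a + b)
DistGe-□ {a = a} {b} dG dH ℓ w with ℓ₁ , ℓ₂ , w₁ , w₂ , eq ← □-walk-split w
  = subst (a + b ≤_) eq (+-mono-≤ (dG ℓ₁ w₁) (dH ℓ₂ w₂))

HasCDL-□ : ∀ G H {m n a b} → HasOrder G m → HasOrder H n → Coprime m n →
  HasCDL G a → HasCDL H b → HasCDL (G □ H) (a + b)
HasCDL-□ G H {a = a} {b} ordG ordH cop (p , φ , φ-dispersed) (q , ψ , ψ-dispersed) =
  q + p * suc q , Φ , Φ-dispersed
  where
  -- suc (q + p * suc q) is suc p * suc q by definition of _*_
  Φ : Fin (suc p * suc q) ⤖ (V G × V H)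
  Φ = (φ ×-⤖ ψ) ⤖-∘ crt-bijection (subst₂ Coprime (sym (⤖-card φ ordG)) (sym (⤖-card ψ ordH)) cop)

  Φ-dispersed : ∀ i → DistGe (G □ H) (Bijection.to Φ i) (Bijection.to Φ (cyc i)) (a + b)
  Φ-dispersed i =
    subst₂ (λ r s → DistGe (G □ H) (Bijection.to Φ i) (Bijection.to φ r , Bijection.to ψ s) (a + b))
      (sym (residue-cyc (∣m⇒∣m*n (suc q) ∣-refl) i)) (sym (residue-cyc (∣n⇒∣m*n (suc p) ∣-refl) i))
      (DistGe-□ (φ-dispersed (residue i)) (ψ-dispersed (residue i)))

theorem3p1 : (G H : Graph) (m n : ℕ) → Connected G → Connected H → HasOrder G m → HasOrder H n → gcd m n ≡ 1 → (a b c : ℕ) → IsDL G a → IsDL H b → IsDL (G □ H) c → a + b ≤ c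
theorem3p1 G H m n _ _ ordG ordH gcd≡1 a b c (labelG , _) (labelH , _) (_ , c-maximal) =
  c-maximal (a + b) (HasCDL-□ G H ordG ordH (gcd≡1⇒coprime gcd≡1) labelG labelH)
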